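{- Let $k\ge1$ be odd. Then $$0\le n_5(k)\le\sqrt{\frac{3k+1}{4}}-1<\sqrt{\frac{3k}{4}}.$$ Moreover $n_5(k)=\sqrt{\frac{3k+1}{4}}-1$ if and only if $k=1+4+16+\dots+4^{a-1}=\frac{4^a-1}{3}$ for some integer $a\ge1$.
   Context: For an integer $k\ge0$ with binary expansion $k=\sum_{i\ge0}\beta_i2^i$, $n_5(k)=\sum_{i\ge2,\ i\text{ even}}\beta_i2^{(i-2)/2}$. -}

module Defs where

open import Data.Nat using (ℕ; _+_; _*_; _^_; _/_; _%_)
open import Data.List using (map; upTo)
open import Data.Nat.ListAction using (sum)
open import Data.Nat.Properties using (m^n≢0)

bit : ℕ → ℕ → ℕ
bit i k = ((k / (2 ^ i)) {{m^n≢0 2 i}}) % 2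

-- n₅ k = Σ_{i ≥ 2, i even} β_i(k) 2^((i-2)/2)
--      = Σ_{j ≥ 0} β_{2j+2}(k) 2^j.
-- The sum is truncated at j < k; this is harmless since for j ≥ k we have
-- 2^(2j+2) > k, so β_{2j+2}(k) = 0.
n₅ : ℕ → ℕ
n₅ k = sum (map (λ j → bit (2 * j + 2) k * 2 ^ j) (upTo k))

{-# OPTIONS --safe #-}
module Submission where

open import Defs
open import Data.Nat using (ℕ; _+_; _*_; _^_; _%_; _∸_; _≤_; _<_)
open import Data.Product using (_×_; ∃-syntax)
open import Relation.Binary.PropositionalEquality using (_≡_)
open import Function.Bundles using (_⇔_)

open import Data.Nat using (zero; suc; _/_; z≤n; s≤s)
open import Data.Nat.Properties
open import Data.Nat.DivMod
open import Data.Nat.Divisibility using (m∣m*n)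
open import Data.Nat.ListAction using (sum)
open import Data.Nat.Tactic.RingSolver using (solve-∀)
open import Data.Nat.Solver using (module +-*-Solver)
open +-*-Solver using (solve; _:=_; con; _:+_; _:*_; _:^_)
open import Data.List using (map; upTo; applyUpTo)
open import Data.List.Properties using (map-cong; map-upTo)
open import Data.Product using (_,_)
open import Data.Empty using (⊥-elim)
open import Function.Base using (_∘_)
open import Function.Bundles using (mk⇔)
open import Function.Construct.Composition using (_⇔-∘_)
open import Relation.Binary.PropositionalEquality using (refl; sym; trans; cong; cong₂; subst)
open ≤-Reasoning

-- Let E q be the number whose binary digits are the even-position bits of q. Appending a
-- base-4 digit r to q (q ↦ r + 4q) sends m = E q to r % 2 + 2m and the deficit 3q − m(m + 2)
-- to 4(3q − m(m + 2)) + slack r m, where slack r m ≥ 0 vanishes only for r = 1 or r = m = 0.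
-- Hence (E q + 1)² ≤ 3q + 1, with equality exactly when every base-4 digit of q is 1, i.e.
-- q = (4^a − 1)/3. For odd k, E k = 2 n₅ k + 1, so 4 (n₅ k + 1)² = (E k + 1)².

-- The first argument is fuel: only the 2n lowest bits of q are read.
evenBits : ℕ → ℕ → ℕ
evenBits zero    q = 0
evenBits (suc n) q = q % 2 + 2 * evenBits n (q / 4)

bit-+2 : ∀ i q → bit (i + 2) q ≡ bit i (q / 4)
bit-+2 i q = cong (_% 2) (begin-equality
  q / 2 ^ (i + 2)  ≡⟨ /-congʳ (trans (^-distribˡ-+-* 2 i 2) (*-comm (2 ^ i) 4)) ⟩
  q / (4 * 2 ^ i)  ≡⟨ m/n/o≡m/[n*o] q 4 (2 ^ i) ⟨
  q / 4 / 2 ^ i    ∎)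
  where instance _ = m^n≢0 2 i
                 _ = m^n≢0 2 (i + 2)
                 _ = m*n≢0 4 (2 ^ i)

sum-applyUpTo-*ˡ : ∀ c {f g : ℕ → ℕ} n → (∀ j → f j ≡ c * g j) →
                   sum (applyUpTo f n) ≡ c * sum (applyUpTo g n)
sum-applyUpTo-*ˡ c         zero    f≡c*g = sym (*-zeroʳ c)
sum-applyUpTo-*ˡ c {f} {g} (suc n) f≡c*g = begin-equality
  f 0 + sum (applyUpTo (f ∘ suc) n)          ≡⟨ cong₂ _+_ (f≡c*g 0) (sum-applyUpTo-*ˡ c n (f≡c*g ∘ suc)) ⟩
  c * g 0 + c * sum (applyUpTo (g ∘ suc) n)  ≡⟨ *-distribˡ-+ c _ _ ⟨
  c * sum (applyUpTo g (suc n))              ∎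

evenBits-sum : ∀ n q → sum (applyUpTo (λ j → bit (2 * j) q * 2 ^ j) n) ≡ evenBits n q
evenBits-sum zero    q = refl
evenBits-sum (suc n) q = cong₂ _+_ lowest-bit (begin-equality
  sum (applyUpTo (λ j → bit (2 * suc j) q * 2 ^ suc j) n)    ≡⟨ sum-applyUpTo-*ˡ 2 n shift ⟩
  2 * sum (applyUpTo (λ j → bit (2 * j) (q / 4) * 2 ^ j) n)  ≡⟨ cong (2 *_) (evenBits-sum n (q / 4)) ⟩
  2 * evenBits n (q / 4)                                     ∎)
  where
  lowest-bit : bit 0 q * 1 ≡ q % 2
  lowest-bit = trans (*-identityʳ _) (cong (_% 2) (n/1≡n q))
  *-comm-middle : ∀ x y z → x * (y * z) ≡ y * (x * z)
  *-comm-middle = solve-∀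
  shift : ∀ j → bit (2 * suc j) q * 2 ^ suc j ≡ 2 * (bit (2 * j) (q / 4) * 2 ^ j)
  shift j = begin-equality
    bit (2 * suc j) q * 2 ^ suc j      ≡⟨ cong (λ i → bit i q * 2 ^ suc j) (*-suc 2 j) ⟩
    bit (2 + 2 * j) q * (2 * 2 ^ j)    ≡⟨ cong (λ i → bit i q * (2 * 2 ^ j)) (+-comm 2 (2 * j)) ⟩
    bit (2 * j + 2) q * (2 * 2 ^ j)    ≡⟨ cong (_* (2 * 2 ^ j)) (bit-+2 (2 * j) q) ⟩
    bit (2 * j) (q / 4) * (2 * 2 ^ j)  ≡⟨ *-comm-middle (bit (2 * j) (q / 4)) 2 (2 ^ j) ⟩
    2 * (bit (2 * j) (q / 4) * 2 ^ j)  ∎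

n₅≡evenBits : ∀ k → n₅ k ≡ evenBits k (k / 4)
n₅≡evenBits k = begin-equality
  sum (map (λ j → bit (2 * j + 2) k * 2 ^ j) (upTo k))
    ≡⟨ cong sum (map-cong (λ j → cong (_* 2 ^ j) (bit-+2 (2 * j) k)) (upTo k)) ⟩
  sum (map (λ j → bit (2 * j) (k / 4) * 2 ^ j) (upTo k))
    ≡⟨ cong sum (map-upTo _ k) ⟩
  sum (applyUpTo (λ j → bit (2 * j) (k / 4) * 2 ^ j) k)
    ≡⟨ evenBits-sum k (k / 4) ⟩
  evenBits k (k / 4)
    ∎

data Base4 : ℕ → Set where
  base4 : ∀ r q → r < 4 → Base4 (r + 4 * q)

toBase4 : ∀ q → Base4 q
toBase4 q = subst Base4 (sym q≡r+4q′) (base4 (q % 4) (q / 4) (m%n<n q 4))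
  where
  q≡r+4q′ : q ≡ q % 4 + 4 * (q / 4)
  q≡r+4q′ = trans (m≡m%n+[m/n]*n q 4) (cong (q % 4 +_) (*-comm (q / 4) 4))

evenBits-base4 : ∀ n r q → r < 4 → evenBits (suc n) (r + 4 * q) ≡ r % 2 + 2 * evenBits n q
evenBits-base4 n r q r<4 = cong₂ (λ b q′ → b + 2 * evenBits n q′) parity quotient
  where
  parity : (r + 4 * q) % 2 ≡ r % 2
  parity = trans (cong (λ x → (r + x) % 2) (trans (*-assoc 2 2 q) (*-comm 2 (2 * q))))
                 ([m+kn]%n≡m%n r (2 * q) 2)
  quotient : (r + 4 * q) / 4 ≡ q
  quotient = begin-equality
    (r + 4 * q) / 4    ≡⟨ +-distrib-/-∣ʳ r (m∣m*n q) ⟩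
    r / 4 + 4 * q / 4  ≡⟨ cong₂ _+_ (m<n⇒m/n≡0 r<4) (trans (/-congˡ (*-comm 4 q)) (m*n/n≡m q 4)) ⟩
    q                  ∎

evenBits-zero : ∀ n → evenBits n 0 ≡ 0
evenBits-zero zero    = refl
evenBits-zero (suc n) = cong (2 *_) (evenBits-zero n)

3[r+4q]≡4[3q]+3r : ∀ r q → 3 * (r + 4 * q) ≡ 4 * (3 * q) + 3 * r
3[r+4q]≡4[3q]+3r = solve-∀

3[1+4q]+1≡4[3q+1] : ∀ q → 3 * (1 + 4 * q) + 1 ≡ 4 * (3 * q + 1)
3[1+4q]+1≡4[3q+1] = solve-∀

-- Junk value 6 for r ≥ 4; only digits r < 4 are ever used.
slack : ℕ → ℕ → ℕ
slack 0 m = 4 * m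
slack 1 m = 0
slack 2 m = 6 + 4 * m
slack _ m = 6

digit-identity : ∀ r → r < 4 → ∀ m →
  (r % 2 + 2 * m) * (r % 2 + 2 * m + 2) + slack r m ≡ 4 * (m * (m + 2)) + 3 * r
digit-identity 0 _ = ring
  where ring : ∀ m → 2 * m * (2 * m + 2) + 4 * m ≡ 4 * (m * (m + 2)) + 0
        ring = solve-∀
digit-identity 1 _ = ring
  where ring : ∀ m → (1 + 2 * m) * (1 + 2 * m + 2) + 0 ≡ 4 * (m * (m + 2)) + 3
        ring = solve-∀
digit-identity 2 _ = ring
  where ring : ∀ m → 2 * m * (2 * m + 2) + (6 + 4 * m) ≡ 4 * (m * (m + 2)) + 6
        ring = solve-∀
digit-identity 3 _ = ring
  where ring : ∀ m → (1 + 2 * m) * (1 + 2 * m + 2) + 6 ≡ 4 * (m * (m + 2)) + 9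
        ring = solve-∀
digit-identity (suc (suc (suc (suc _)))) (s≤s (s≤s (s≤s (s≤s ()))))

digit-bound : ∀ r q m → r < 4 → m * (m + 2) ≤ 3 * q → let M = r % 2 + 2 * m in
              M * (M + 2) + slack r m ≤ 3 * (r + 4 * q)
digit-bound r q m r<4 s≤3q = begin
  (r % 2 + 2 * m) * (r % 2 + 2 * m + 2) + slack r m  ≡⟨ digit-identity r r<4 m ⟩
  4 * (m * (m + 2)) + 3 * r                          ≤⟨ +-monoˡ-≤ (3 * r) (*-monoʳ-≤ 4 s≤3q) ⟩
  4 * (3 * q) + 3 * r                                ≡⟨ 3[r+4q]≡4[3q]+3r r q ⟨
  3 * (r + 4 * q)                                    ∎

evenBits-bound : ∀ n q → evenBits n q * (evenBits n q + 2) ≤ 3 * q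
evenBits-bound zero    q = z≤n
evenBits-bound (suc n) q with toBase4 q
... | base4 r q′ r<4 rewrite evenBits-base4 n r q′ r<4 =
  m+n≤o⇒m≤o _ (digit-bound r q′ (evenBits n q′) r<4 (evenBits-bound n q′))

digit-tight : ∀ r q m → r < 4 → m * (m + 2) ≤ 3 * q → let M = r % 2 + 2 * m in
              M * (M + 2) ≡ 3 * (r + 4 * q) → slack r m ≡ 0 × m * (m + 2) ≡ 3 * q
digit-tight r q m r<4 s≤3q S≡ =
  slack≡0 , *-cancelˡ-≡ _ _ 4 (+-cancelʳ-≡ (3 * r) _ _ (begin-equality
    4 * (m * (m + 2)) + 3 * r  ≡⟨ digit-identity r r<4 m ⟨
    S + slack r m              ≡⟨ cong₂ _+_ S≡ slack≡0 ⟩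
    3 * (r + 4 * q) + 0        ≡⟨ +-identityʳ _ ⟩
    3 * (r + 4 * q)            ≡⟨ 3[r+4q]≡4[3q]+3r r q ⟩
    4 * (3 * q) + 3 * r        ∎))
  where
  S = (r % 2 + 2 * m) * (r % 2 + 2 * m + 2)
  slack≡0 : slack r m ≡ 0
  slack≡0 = n≤0⇒n≡0 (+-cancelˡ-≤ S _ _ (begin
    S + slack r m    ≤⟨ digit-bound r q m r<4 s≤3q ⟩
    3 * (r + 4 * q)  ≡⟨ S≡ ⟨
    S                ≡⟨ +-identityʳ S ⟨
    S + 0            ∎))

PowerOf4 : ℕ → Set
PowerOf4 x = ∃[ a ] x ≡ 4 ^ a

digit-tight⇒powerOf4 : ∀ r q m → r < 4 → m * (m + 2) ≤ 3 * q →
                       (m * (m + 2) ≡ 3 * q → PowerOf4 (3 * q + 1)) →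
                       let M = r % 2 + 2 * m in M * (M + 2) ≡ 3 * (r + 4 * q) →
                       PowerOf4 (3 * (r + 4 * q) + 1)
digit-tight⇒powerOf4 r q m r<4 s≤3q ih S≡ with digit-tight r q m r<4 s≤3q S≡
digit-tight⇒powerOf4 0 q zero    _ _ _  S≡ | _        = 0 , cong (_+ 1) (sym S≡)
digit-tight⇒powerOf4 0 q (suc m) _ _ _  _  | () , _
digit-tight⇒powerOf4 1 q m       _ _ ih _  | _ , s≡3q with ih s≡3q
... | a , 3q+1≡4^a = suc a , trans (3[1+4q]+1≡4[3q+1] q) (cong (4 *_) 3q+1≡4^a)
digit-tight⇒powerOf4 2 q m       _ _ _  _  | () , _
digit-tight⇒powerOf4 3 q m       _ _ _  _  | () , _
digit-tight⇒powerOf4 (suc (suc (suc (suc _)))) _ _ (s≤s (s≤s (s≤s (s≤s ())))) _ _ _ | _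

evenBits-tight⇒powerOf4 : ∀ n q → evenBits n q * (evenBits n q + 2) ≡ 3 * q → PowerOf4 (3 * q + 1)
evenBits-tight⇒powerOf4 zero    q e = 0 , cong (_+ 1) (sym e)
evenBits-tight⇒powerOf4 (suc n) q e with toBase4 q
... | base4 r q′ r<4 =
  digit-tight⇒powerOf4 r q′ (evenBits n q′) r<4 (evenBits-bound n q′) (evenBits-tight⇒powerOf4 n q′)
    (subst (λ M → M * (M + 2) ≡ 3 * (r + 4 * q′)) (evenBits-base4 n r q′ r<4) e)

repunit₄ : ℕ → ℕ
repunit₄ zero    = 0
repunit₄ (suc a) = 1 + 4 * repunit₄ a

3*repunit₄+1≡4^a : ∀ a → 3 * repunit₄ a + 1 ≡ 4 ^ a
3*repunit₄+1≡4^a zero    = refl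
3*repunit₄+1≡4^a (suc a) = trans (3[1+4q]+1≡4[3q+1] (repunit₄ a)) (cong (4 *_) (3*repunit₄+1≡4^a a))

3q+1≡4^a⇒q≡repunit₄ : ∀ q a → 3 * q + 1 ≡ 4 ^ a → q ≡ repunit₄ a
3q+1≡4^a⇒q≡repunit₄ q a e =
  *-cancelˡ-≡ q (repunit₄ a) 3 (+-cancelʳ-≡ 1 _ _ (trans e (sym (3*repunit₄+1≡4^a a))))

a≤repunit₄ : ∀ a → a ≤ repunit₄ a
a≤repunit₄ zero    = z≤n
a≤repunit₄ (suc a) = s≤s (≤-trans (a≤repunit₄ a) (m≤n*m (repunit₄ a) 4))

evenBits-repunit₄ : ∀ n a → a ≤ n → let m = evenBits n (repunit₄ a) in m * (m + 2) ≡ 3 * repunit₄ a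
evenBits-repunit₄ n       zero    _         = cong (λ m → m * (m + 2)) (evenBits-zero n)
evenBits-repunit₄ (suc n) (suc a) (s≤s a≤n) = begin-equality
  M * (M + 2)                        ≡⟨ cong (λ x → x * (x + 2)) (evenBits-base4 n 1 (repunit₄ a) 1<4) ⟩
  (1 + 2 * m) * (1 + 2 * m + 2)      ≡⟨ +-identityʳ _ ⟨
  (1 + 2 * m) * (1 + 2 * m + 2) + 0  ≡⟨ digit-identity 1 1<4 m ⟩
  4 * (m * (m + 2)) + 3              ≡⟨ cong (λ x → 4 * x + 3) (evenBits-repunit₄ n a a≤n) ⟩
  4 * (3 * repunit₄ a) + 3           ≡⟨ 3[r+4q]≡4[3q]+3r 1 (repunit₄ a) ⟨
  3 * repunit₄ (suc a)               ∎
  where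
  m = evenBits n (repunit₄ a)
  M = evenBits (suc n) (repunit₄ (suc a))
  1<4 : 1 < 4
  1<4 = s≤s (s≤s z≤n)

powerOf4⇒evenBits-tight : ∀ n q → q ≤ n → PowerOf4 (3 * q + 1) →
                          evenBits n q * (evenBits n q + 2) ≡ 3 * q
powerOf4⇒evenBits-tight n q q≤n (a , e) with 3q+1≡4^a⇒q≡repunit₄ q a e
... | refl = evenBits-repunit₄ n a (≤-trans (a≤repunit₄ a) q≤n)

evenBits-tight⇔powerOf4 : ∀ n q → q ≤ n →
  (evenBits n q * (evenBits n q + 2) ≡ 3 * q) ⇔ PowerOf4 (3 * q + 1)
evenBits-tight⇔powerOf4 n q q≤n =
  mk⇔ (evenBits-tight⇒powerOf4 n q) (powerOf4⇒evenBits-tight n q q≤n)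

powerOf4[3k+1]⇔3k≡4^a∸1 : ∀ {k} → 1 ≤ k →
  PowerOf4 (3 * k + 1) ⇔ (∃[ a ] (1 ≤ a × 3 * k ≡ 4 ^ a ∸ 1))
powerOf4[3k+1]⇔3k≡4^a∸1 {k} 1≤k = mk⇔ to from
  where
  to : PowerOf4 (3 * k + 1) → ∃[ a ] (1 ≤ a × 3 * k ≡ 4 ^ a ∸ 1)
  to (zero  , e) = ⊥-elim (n>0⇒n≢0 1≤k (*-cancelˡ-≡ k 0 3 (+-cancelʳ-≡ 1 _ _ e)))
  to (suc a , e) = suc a , s≤s z≤n , trans (sym (m+n∸n≡m (3 * k) 1)) (cong (_∸ 1) e)
  from : ∃[ a ] (1 ≤ a × 3 * k ≡ 4 ^ a ∸ 1) → PowerOf4 (3 * k + 1)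
  from (a , _ , e) = a , trans (cong (_+ 1) e) (m∸n+n≡m (m^n>0 4 a))

4[m+1]²≡[1+2m][3+2m]+1 : ∀ m → 4 * (m + 1) ^ 2 ≡ (1 + 2 * m) * (1 + 2 * m + 2) + 1
4[m+1]²≡[1+2m][3+2m]+1 = solve 1 (λ m →
  con 4 :* (m :+ con 1) :^ 2 := (con 1 :+ con 2 :* m) :* (con 1 :+ con 2 :* m :+ con 2) :+ con 1) refl

4[m+1]²≤x+1⇒4m²<x : ∀ m x → 4 * (m + 1) ^ 2 ≤ x + 1 → 4 * m ^ 2 < x
4[m+1]²≤x+1⇒4m²<x m x h = +-cancelʳ-≤ 1 _ _ (begin
  1 + 4 * m ^ 2 + 1                ≤⟨ m≤m+n _ (8 * m + 2) ⟩
  1 + 4 * m ^ 2 + 1 + (8 * m + 2)  ≡⟨ ring m ⟩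
  4 * (m + 1) ^ 2                  ≤⟨ h ⟩
  x + 1                            ∎)
  where
  ring : ∀ m → 1 + 4 * m ^ 2 + 1 + (8 * m + 2) ≡ 4 * (m + 1) ^ 2
  ring = solve 1 (λ m →
    con 1 :+ con 4 :* m :^ 2 :+ con 1 :+ (con 8 :* m :+ con 2) := con 4 :* (m :+ con 1) :^ 2) refl

proposition5p7 : (k : ℕ) → 1 ≤ k → k % 2 ≡ 1 →
    (4 * (n₅ k + 1) ^ 2 ≤ 3 * k + 1)
    × (4 * n₅ k ^ 2 < 3 * k)
    × ((4 * (n₅ k + 1) ^ 2 ≡ 3 * k + 1) ⇔ (∃[ a ] (1 ≤ a × 3 * k ≡ 4 ^ a ∸ 1)))
proposition5p7 k 1≤k k-odd = bound , 4[m+1]²≤x+1⇒4m²<x (n₅ k) (3 * k) bound , tight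
  where
  M = evenBits (suc k) k
  M≡1+2n₅ : M ≡ 1 + 2 * n₅ k
  M≡1+2n₅ = cong₂ (λ b m → b + 2 * m) k-odd (sym (n₅≡evenBits k))
  4[n₅+1]²≡M[M+2]+1 : 4 * (n₅ k + 1) ^ 2 ≡ M * (M + 2) + 1
  4[n₅+1]²≡M[M+2]+1 = trans (4[m+1]²≡[1+2m][3+2m]+1 (n₅ k)) (cong (λ x → x * (x + 2) + 1) (sym M≡1+2n₅))
  bound : 4 * (n₅ k + 1) ^ 2 ≤ 3 * k + 1
  bound = begin
    4 * (n₅ k + 1) ^ 2  ≡⟨ 4[n₅+1]²≡M[M+2]+1 ⟩
    M * (M + 2) + 1     ≤⟨ +-monoˡ-≤ 1 (evenBits-bound (suc k) k) ⟩
    3 * k + 1           ∎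
  tight-M : (4 * (n₅ k + 1) ^ 2 ≡ 3 * k + 1) ⇔ (M * (M + 2) ≡ 3 * k)
  tight-M = mk⇔ (λ e → +-cancelʳ-≡ 1 _ _ (trans (sym 4[n₅+1]²≡M[M+2]+1) e))
                (λ e → trans 4[n₅+1]²≡M[M+2]+1 (cong (_+ 1) e))
  tight : (4 * (n₅ k + 1) ^ 2 ≡ 3 * k + 1) ⇔ (∃[ a ] (1 ≤ a × 3 * k ≡ 4 ^ a ∸ 1))
  tight = powerOf4[3k+1]⇔3k≡4^a∸1 1≤k ⇔-∘ (evenBits-tight⇔powerOf4 (suc k) k (n≤1+n k) ⇔-∘ tight-M)
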